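{- Consider Algorithm L (defined in the context) run on a tree network with half-duplex links and $k$ agents, exactly one of which is the leader. Starting from a legitimate configuration, the naming problem is solved: the non-leader agents have pairwise distinct identifiers, and no agent ever changes its identifier afterwards.
   Context: Model. The network is a finite tree with half-duplex links: two agents at neighbouring nodes cannot cross the same edge in opposite directions in the same step. Ports at a node of degree $\delta$ are $0,\dots,\delta-1$. There are $k$ agents; exactly one carries a special leader mark, recognizable by nodes and not in the domain of non-leader identifiers. Each non-leader agent holds an integer $\mathtt{id}$. Each node's whiteboard holds a single port variable $\mathtt{edge}$. The scheduler repeatedly chooses a set of nodes hosting at least one agent. An activated node first executes the code of each non-leader agent it hosts, sequentially, and then the code of the leader if present. The scheduler is fair: every node hosting an agent is eventually activated. Algorithm L. At a node of degree $\delta$ with whiteboard variable $\mathtt{edge}$: - The leader sets $\mathtt{edge}:=(\mathtt{edge}+1)\bmod\delta$ and leaves through port $\mathtt{edge}$. - A non-leader agent, if the leader is at the same node, first replaces its $\mathtt{id}$ by a fresh identifier if its $\mathtt{id}$ is shared by another agent present at the node; it then leaves through port $(\mathtt{edge}+1)\bmod\delta$, which is the same exit the leader will take. - A non-leader agent, if the leader is not at the same node, leaves through port $\mathtt{edge}$. Legitimate configuration. A configuration is legitimate if all three of the following hold: (i) all non-leader agents have pairwise distinct identifiers; (ii) all agents are located at the same node; (iii) every whiteboard's $\mathtt{edge}$ points toward the node containing all agents. -}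

module Defs where

open import Data.Nat using (ℕ; zero; suc; _≥_)
open import Data.Nat.DivMod using (_mod_)
open import Data.Fin using (Fin; toℕ; _≟_)
open import Data.Bool using (Bool; true; false; if_then_else_)
open import Data.Vec using (Vec; lookup)
open import Data.List using (List; []; _∷_)
open import Data.List.Membership.Propositional using (_∈_)
open import Data.List.Relation.Unary.Unique.Propositional using (Unique)
open import Data.Product using (Σ; ∃; _×_; _,_)
open import Data.Empty using (⊥)
open import Relation.Nullary using (¬_; Dec; yes; no)
open import Relation.Binary.PropositionalEquality using (_≡_; _≢_)
open import Function using (Injective)
open import Function.Bundles using (_⇔_)
open import Relation.Binary.Construct.Closure.ReflexiveTransitive using (Star)
import Data.Fin.Properties as FinP

next : ∀ {δ} → Fin δ → Fin δ
next {suc m} i = suc (toℕ i) mod suc m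

record PortGraph (n : ℕ) : Set where
  field
    deg     : Fin n → ℕ
    nbr     : (v : Fin n) → Fin (deg v) → Fin n
    nbr-inj : ∀ v {p q} → nbr v p ≡ nbr v q → p ≡ q
    no-loop : ∀ v p → nbr v p ≢ v
    sym     : ∀ v p → ∃ λ q → nbr (nbr v p) q ≡ v

module _ {n : ℕ} (G : PortGraph n) where
  open PortGraph G

  Adj : Fin n → Fin n → Set
  Adj u w = ∃ λ p → nbr u p ≡ w

  data WalkIn (P : Fin n → Set) : Fin n → Fin n → Set where
    here : ∀ {u} → P u → WalkIn P u u
    step : ∀ {u w x} → P u → Adj u w → WalkIn P w x → WalkIn P u x

  Walk : Fin n → Fin n → Set
  Walk = WalkIn (λ _ → Fin n)

  record Cycle : Set where
    field
      len      : ℕ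
      len≥3    : len ≥ 3
      vs       : Vec (Fin n) len
      distinct : Injective _≡_ _≡_ (lookup vs)
      adjacent : ∀ (i : Fin len) →
                   Adj (lookup vs i) (lookup vs (next i))

record Tree (n : ℕ) : Set where
  field
    graph     : PortGraph n
    connected : ∀ u w → Walk graph u w
    acyclic   : ¬ Cycle graph
  open PortGraph graph public

-- Mobile-agent model and Algorithm L on a tree T with k agents, agent ℓ
-- being the (unique) leader.  Identifiers of the leader are irrelevant
-- (never read, never written).

record Config {n : ℕ} (T : Tree n) (k : ℕ) : Set where
  open Tree T
  field
    pos : Fin k → Fin n
    ids : Fin k → ℕ
    wb  : (v : Fin n) → Fin (deg v)

module Model {n : ℕ} (T : Tree n) (k : ℕ) (ℓ : Fin k) where
  open Tree T
  open Config

  update : (Fin k → ℕ) → Fin k → ℕ → (Fin k → ℕ)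
  update f a x b with b ≟ a
  ... | yes _ = x
  ... | no  _ = f b

  exitPort : (C : Config T k) (a : Fin k) → Fin (deg (pos C a))
  exitPort C a with a ≟ ℓ
  ... | yes _ = next (wb C (pos C a))
  ... | no  _ with pos C ℓ ≟ pos C a
  ...   | yes _ = next (wb C (pos C a))
  ...   | no  _ = wb C (pos C a)

  newPos : (C : Config T k) → (Fin n → Bool) → Fin k → Fin n
  newPos C act a = if act (pos C a) then nbr (pos C a) (exitPort C a) else pos C a

  newWb : (C : Config T k) → (Fin n → Bool) → (v : Fin n) → Fin (deg v)
  newWb C act v with act v | pos C ℓ ≟ v
  ... | true | yes _ = next (wb C v)
  ... | _    | _     = wb C v

  -- identifier of a is shared by another non-leader agent still present
  -- at a's node (the agents of `rest` have not yet executed/left)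
  Dup : Config T k → Fin k → List (Fin k) → (Fin k → ℕ) → Set
  Dup C a rest f = ∃ λ b → b ∈ rest × pos C b ≡ pos C a × f b ≡ f a

  Fresh : ℕ → (Fin k → ℕ) → Set
  Fresh x f = ∀ b → b ≢ ℓ → f b ≢ x

  data Run (C : Config T k) : List (Fin k) → (Fin k → ℕ) → (Fin k → ℕ) → Set where
    done   : ∀ {f} → Run C [] f f
    keep   : ∀ {a rest f f'} →
             (pos C ℓ ≡ pos C a → ¬ Dup C a rest f) →
             Run C rest f f' → Run C (a ∷ rest) f f'
    rename : ∀ {a rest f f'} (x : ℕ) →
             pos C ℓ ≡ pos C a → Dup C a rest f → Fresh x f →
             Run C rest (update f a x) f' → Run C (a ∷ rest) f f'

  record Step (C C' : Config T k) : Set where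
    field
      act         : Fin n → Bool
      nonempty    : ∃ λ v → act v ≡ true
      hosted      : ∀ v → act v ≡ true → ∃ λ a → pos C a ≡ v
      ord         : List (Fin k)
      ord-unique  : Unique ord
      ord-members : ∀ a → (a ∈ ord) ⇔ (a ≢ ℓ × act (pos C a) ≡ true)
      run         : Run C ord (ids C) (ids C')
      pos-eq      : ∀ a → pos C' a ≡ newPos C act a
      wb-eq       : ∀ v → wb C' v ≡ newWb C act v
      half-duplex : ∀ a b → act (pos C a) ≡ true → act (pos C b) ≡ true →
                    newPos C act a ≡ pos C b → newPos C act b ≡ pos C a → ⊥

  Reachable : Config T k → Config T k → Set
  Reachable = Star Step

  Distinct : Config T k → Set
  Distinct C = ∀ a b → a ≢ ℓ → b ≢ ℓ → a ≢ b → ids C a ≢ ids C b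

  -- whiteboard of v points toward c: the neighbour behind port edge lies
  -- on c's side of v (is joined to c by a walk avoiding v)
  PointsToward : Config T k → Fin n → Fin n → Set
  PointsToward C v c = WalkIn graph (λ x → x ≢ v) (nbr v (wb C v)) c

  Legitimate : Config T k → Set
  Legitimate C = Distinct C × (∃ λ c → (∀ a → pos C a ≡ c) ×
                                       (∀ v → v ≢ c → PointsToward C v c))

module Submission where

-- Under Algorithm L an agent changes its identifier only when
-- it shares it with another agent present at its node; if all non-leader
-- identifiers are already pairwise distinct, no such agent exists, so no
-- identifier ever changes.  Distinctness is therefore an invariant, and it
-- is the only part of legitimacy the theorem needs.

open import Defs
open import Data.Nat using (ℕ)
open import Data.Fin using (Fin)
open import Data.Product using (_×_; _,_; proj₁)
open import Data.List.Membership.Propositional using (_∈_)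
open import Data.List.Relation.Unary.Any using (here; there)
open import Data.List.Relation.Unary.All using (lookup)
open import Data.List.Relation.Unary.AllPairs using (_∷_)
open import Data.List.Relation.Unary.Unique.Propositional using (Unique)
open import Data.Empty using (⊥-elim)
open import Function.Bundles using (Equivalence)
open import Relation.Binary.PropositionalEquality
  using (_≡_; _≢_; _≗_; refl; sym; trans)
open import Relation.Binary.Construct.Closure.ReflexiveTransitive using (ε; _◅_)

module Naming {n : ℕ} (T : Tree n) (k : ℕ) (ℓ : Fin k) where
  open Model T k ℓ
  open Config

  DistinctIds : (Fin k → ℕ) → Set
  DistinctIds f = ∀ a b → a ≢ ℓ → b ≢ ℓ → a ≢ b → f a ≢ f b

  distinct-respects-≗ : ∀ {f g} → g ≗ f → DistinctIds f → DistinctIds g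
  distinct-respects-≗ g≗f d a b a≢ℓ b≢ℓ a≢b ga≡gb =
    d a b a≢ℓ b≢ℓ a≢b (trans (sym (g≗f a)) (trans ga≡gb (g≗f b)))

  -- A run of non-leader agents, each listed once, starting from distinct
  -- identifiers renames nobody: a `rename` would need another agent c of
  -- the remaining list with the same identifier, and c ≢ a by uniqueness.
  run-keeps-ids : ∀ {C agents f f'} →
                  (∀ a → a ∈ agents → a ≢ ℓ) → Unique agents → DistinctIds f →
                  Run C agents f f' → f' ≗ f
  run-keeps-ids nonLeader unique d done = λ _ → refl
  run-keeps-ids nonLeader (_ ∷ unique) d (keep _ run) =
    run-keeps-ids (λ a a∈ → nonLeader a (there a∈)) unique d run
  run-keeps-ids nonLeader (a≢rest ∷ _) d (rename _ _ (c , c∈rest , _ , fc≡fa) _ _) =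
    ⊥-elim (d _ c (nonLeader _ (here refl)) (nonLeader c (there c∈rest))
                  (lookup a≢rest c∈rest) (sym fc≡fa))

  -- One scheduler step from a configuration with distinct identifiers
  -- changes no identifier: the agents executed in a step are exactly the
  -- (distinct) non-leader agents of the activated nodes.
  step-keeps-ids : ∀ {C C'} → Distinct C → Step C C' → ids C' ≗ ids C
  step-keeps-ids d s = run-keeps-ids nonLeader (Step.ord-unique s) d (Step.run s)
    where
    nonLeader : ∀ a → a ∈ Step.ord s → a ≢ ℓ
    nonLeader a a∈ = proj₁ (Equivalence.to (Step.ord-members s a) a∈)

  reachable-keeps-ids : ∀ {C C'} → Distinct C → Reachable C C' → ids C' ≗ ids C
  reachable-keeps-ids d ε = λ _ → refl
  reachable-keeps-ids d (s ◅ rest) =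
    let firstStep = step-keeps-ids d s
        afterwards = reachable-keeps-ids (distinct-respects-≗ firstStep d) rest
    in λ a → trans (afterwards a) (firstStep a)

mainTheorem9 : ∀ {n} (T : Tree n) (k : ℕ) (ℓ : Fin k) (C C' : Config T k) →
                 Model.Legitimate T k ℓ C → Model.Reachable T k ℓ C C' →
                 Model.Distinct T k ℓ C' ×
                 (∀ a → a ≢ ℓ → Config.ids C' a ≡ Config.ids C a)
mainTheorem9 T k ℓ C C' (distinct , _) reach =
  distinct-respects-≗ idsUnchanged distinct , λ a _ → idsUnchanged a
  where
  open Naming T k ℓ
  idsUnchanged : Config.ids C' ≗ Config.ids C
  idsUnchanged = reachable-keeps-ids distinct reach
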